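{- Let $G$ and $H$ be digraphs such that $\gamma(G\mathbin{\Box} H)=\gamma(G)\gamma(H)$. Suppose $G'$ is obtained from $G$ by adding a new vertex $x$ and a single arc $xv$ for some vertex $v$ of $G$, such that $\gamma(G')=\gamma(G)+1$ and $G'$ satisfies Vizing's inequality. Then $\gamma(G'\mathbin{\Box} H)=\gamma(G')\gamma(H)$.
   Context: All digraphs are finite, and their arc relation is irreflexive. A set $S$ is dominating if every vertex not in $S$ is an out-neighbor of some vertex of $S$; $\gamma$ is the minimum size of a dominating set. The Cartesian product $G\mathbin{\Box} H$ has vertex set $V(G)\times V(H)$, with an arc from $(g_1,h_1)$ to $(g_2,h_2)$ iff either $g_1=g_2$ and $h_1h_2\in A(H)$, or $h_1=h_2$ and $g_1g_2\in A(G)$. A digraph $G'$ satisfies Vizing's inequality if $\gamma(G'\mathbin{\Box} K)\ge\gamma(G')\gamma(K)$ for every digraph $K$. -}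

module Defs where

open import Data.Nat using (ℕ; zero; suc; _*_; _≤_)
open import Data.Fin using (Fin; zero; suc; remQuot; _≟_)
open import Data.Fin.Subset using (Subset; _∈_; ∣_∣)
open import Data.Bool using (Bool; true; false; _∧_; _∨_)
open import Data.Bool.Properties using (∧-zeroʳ)
open import Data.Product using (Σ; ∃-syntax; _×_; _,_)
open import Data.Sum using (_⊎_)
open import Relation.Nullary.Decidable using (⌊_⌋)
open import Relation.Binary.PropositionalEquality using (_≡_; refl; cong₂)

record Digraph : Set where
  field
    n      : ℕ
    arc    : Fin n → Fin n → Bool
    irrefl : ∀ i → arc i i ≡ false
open Digraph public

Dominating : (G : Digraph) → Subset (n G) → Set
Dominating G S = ∀ w → w ∈ S ⊎ ∃[ u ] (u ∈ S × arc G u w ≡ true)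

IsDomNum : Digraph → ℕ → Set
IsDomNum G k =
  Σ (Subset (n G)) (λ S → Dominating G S × ∣ S ∣ ≡ k)
  × (∀ S → Dominating G S → k ≤ ∣ S ∣)

-- Cartesian product G □ H, vertex set Fin (n G * n H) ≅ Fin (n G) × Fin (n H)
-- via remQuot / combine.
pairArc : (G H : Digraph) → Fin (n G) × Fin (n H) → Fin (n G) × Fin (n H) → Bool
pairArc G H (g₁ , h₁) (g₂ , h₂) =
  (⌊ g₁ ≟ g₂ ⌋ ∧ arc H h₁ h₂) ∨ (⌊ h₁ ≟ h₂ ⌋ ∧ arc G g₁ g₂)

pairIrrefl : (G H : Digraph) → ∀ p → pairArc G H p p ≡ false
pairIrrefl G H (g , h) rewrite irrefl H h | irrefl G g
  | ∧-zeroʳ ⌊ g ≟ g ⌋ | ∧-zeroʳ ⌊ h ≟ h ⌋ = refl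

prodArc : (G H : Digraph) → Fin (n G * n H) → Fin (n G * n H) → Bool
prodArc G H i j = pairArc G H (remQuot (n H) i) (remQuot (n H) j)

prodIrrefl : (G H : Digraph) → ∀ i → prodArc G H i i ≡ false
prodIrrefl G H i = pairIrrefl G H (remQuot (n H) i)

_□_ : Digraph → Digraph → Digraph
G □ H = record { n = n G * n H ; arc = prodArc G H ; irrefl = prodIrrefl G H }

-- G' : add a new vertex x (= zero) to G (old vertices shifted by suc)
-- and a single arc x → v.
pendArc : (G : Digraph) → Fin (n G) → Fin (suc (n G)) → Fin (suc (n G)) → Bool
pendArc G v zero    zero    = false
pendArc G v zero    (suc j) = ⌊ j ≟ v ⌋
pendArc G v (suc i) zero    = false
pendArc G v (suc i) (suc j) = arc G i j

pendIrrefl : (G : Digraph) (v : Fin (n G)) → ∀ i → pendArc G v i i ≡ false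
pendIrrefl G v zero    = refl
pendIrrefl G v (suc i) = irrefl G i

addPendant : (G : Digraph) → Fin (n G) → Digraph
addPendant G v = record { n = suc (n G) ; arc = pendArc G v ; irrefl = pendIrrefl G v }

SatisfiesVizing : Digraph → Set
SatisfiesVizing G' =
  ∀ (K : Digraph) (a b c : ℕ) →
  IsDomNum G' a → IsDomNum K b → IsDomNum (G' □ K) c → a * b ≤ c

-- The vertices of G' □ H split into the fibre {x} × H, a copy of H, and V(G) × H,
-- a copy of G □ H (the arc x v only joins the two parts).  A dominating set of H
-- on the fibre together with a minimum dominating set of G □ H therefore
-- dominates G' □ H, so γ(G' □ H) ≤ γ(H) + γ(G)γ(H) = γ(G')γ(H); Vizing's
-- inequality for G' is the reverse bound.
module Submission where

open import Defs
open import Data.Nat using (ℕ; suc; _*_; _+_; _≤_)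
open import Data.Nat.Properties using (≤-antisym; ≤-trans; ≤-reflexive)
open import Data.Fin using (Fin; zero; suc; _≟_; _↑ˡ_; _↑ʳ_; splitAt; remQuot)
open import Data.Fin.Properties using (splitAt-↑ʳ; splitAt⁻¹-↑ˡ; splitAt⁻¹-↑ʳ; remQuot-combine)
open import Data.Fin.Subset using (Subset; _∈_; ∣_∣; inside; outside)
open import Data.Vec using ([]; _∷_; _++_; here; there)
open import Data.Bool using (true; _∧_; _∨_)
open import Data.Bool.Properties using (∧-zeroʳ; ∨-identityʳ)
open import Data.Product using (_×_; _,_; ∃-syntax; map₁)
open import Data.Sum using (_⊎_; inj₁; inj₂)
open import Relation.Nullary.Decidable using (⌊_⌋; ⌊⌋-map′)
open import Relation.Binary.PropositionalEquality using (_≡_; refl; trans; cong; cong₂; subst)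

∣p++q∣≡∣p∣+∣q∣ : ∀ {k l} (p : Subset k) (q : Subset l) → ∣ p ++ q ∣ ≡ ∣ p ∣ + ∣ q ∣
∣p++q∣≡∣p∣+∣q∣ []            q = refl
∣p++q∣≡∣p∣+∣q∣ (outside ∷ p) q = ∣p++q∣≡∣p∣+∣q∣ p q
∣p++q∣≡∣p∣+∣q∣ (inside  ∷ p) q = cong suc (∣p++q∣≡∣p∣+∣q∣ p q)

∈-++⁺ˡ : ∀ {k l} {p : Subset k} (q : Subset l) {i} → i ∈ p → i ↑ˡ l ∈ p ++ q
∈-++⁺ˡ q here        = here
∈-++⁺ˡ q (there i∈p) = there (∈-++⁺ˡ q i∈p)

∈-++⁺ʳ : ∀ {k l} (p : Subset k) {q : Subset l} {j} → j ∈ q → k ↑ʳ j ∈ p ++ q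
∈-++⁺ʳ []      j∈q = j∈q
∈-++⁺ʳ (_ ∷ p) j∈q = there (∈-++⁺ʳ p j∈q)

remQuot-↑ʳ : ∀ {k} l (j : Fin (k * l)) → remQuot {suc k} l (l ↑ʳ j) ≡ map₁ suc (remQuot {k} l j)
remQuot-↑ʳ {k} l j rewrite splitAt-↑ʳ l (k * l) j = refl

DominatedBy : (K : Digraph) → Subset (n K) → Fin (n K) → Set
DominatedBy K S w = w ∈ S ⊎ ∃[ u ] (u ∈ S × arc K u w ≡ true)

dominatedBy-embedding : (K L : Digraph) (f : Fin (n K) → Fin (n L)) →
  (∀ u w → arc L (f u) (f w) ≡ arc K u w) →
  {S : Subset (n K)} {T : Subset (n L)} → (∀ {u} → u ∈ S → f u ∈ T) →
  Dominating K S → ∀ w → DominatedBy L T (f w)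
dominatedBy-embedding K L f f-arc S⊆T dom w with dom w
... | inj₁ w∈S             = inj₁ (S⊆T w∈S)
... | inj₂ (u , u∈S , uw) = inj₂ (f u , S⊆T u∈S , trans (f-arc u w) uw)

module _ (G H : Digraph) (v : Fin (n G)) where

  private
    G' : Digraph
    G' = addPendant G v

  pairArc-addPendant-zero : ∀ i j → pairArc G' H (zero , i) (zero , j) ≡ arc H i j
  pairArc-addPendant-zero i j rewrite ∧-zeroʳ ⌊ i ≟ j ⌋ = ∨-identityʳ (arc H i j)

  arc-□-addPendant-↑ˡ : ∀ i j →
    arc (G' □ H) (i ↑ˡ n G * n H) (j ↑ˡ n G * n H) ≡ arc H i j
  arc-□-addPendant-↑ˡ i j =
    trans (cong₂ (pairArc G' H) (remQuot-combine zero i) (remQuot-combine zero j))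
          (pairArc-addPendant-zero i j)

  pairArc-addPendant-suc : ∀ ((g₁ , h₁) (g₂ , h₂) : Fin (n G) × Fin (n H)) →
    pairArc G' H (suc g₁ , h₁) (suc g₂ , h₂) ≡ pairArc G H (g₁ , h₁) (g₂ , h₂)
  pairArc-addPendant-suc (g₁ , h₁) (g₂ , h₂) =
    cong (λ b → (b ∧ arc H h₁ h₂) ∨ (⌊ h₁ ≟ h₂ ⌋ ∧ arc G g₁ g₂)) (⌊⌋-map′ _ _ (g₁ ≟ g₂))

  arc-□-addPendant-↑ʳ : ∀ i j →
    arc (G' □ H) (n H ↑ʳ i) (n H ↑ʳ j) ≡ arc (G □ H) i j
  arc-□-addPendant-↑ʳ i j =
    trans (cong₂ (pairArc G' H) (remQuot-↑ʳ (n H) i) (remQuot-↑ʳ (n H) j))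
          (pairArc-addPendant-suc (remQuot (n H) i) (remQuot (n H) j))

  dominating-++ : ∀ {S D} → Dominating H S → Dominating (G □ H) D →
    Dominating (G' □ H) (S ++ D)
  dominating-++ {S} {D} domS domD w = by-side (splitAt (n H) w) refl
    where
    by-side : ∀ side → splitAt (n H) w ≡ side → DominatedBy (G' □ H) (S ++ D) w
    by-side (inj₁ i) eq = subst (DominatedBy (G' □ H) (S ++ D)) (splitAt⁻¹-↑ˡ eq)
      (dominatedBy-embedding H (G' □ H) (_↑ˡ n G * n H) arc-□-addPendant-↑ˡ (∈-++⁺ˡ D) domS i)
    by-side (inj₂ j) eq = subst (DominatedBy (G' □ H) (S ++ D)) (splitAt⁻¹-↑ʳ eq)
      (dominatedBy-embedding (G □ H) (G' □ H) (n H ↑ʳ_) arc-□-addPendant-↑ʳ (∈-++⁺ʳ S) domD j)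

  domNum-addPendant-□-≤ : ∀ {a b c} →
    IsDomNum H a → IsDomNum (G □ H) b → IsDomNum (G' □ H) c → c ≤ a + b
  domNum-addPendant-□-≤ ((S , domS , refl) , _) ((D , domD , refl) , _) (_ , minimal) =
    ≤-trans (minimal (S ++ D) (dominating-++ domS domD)) (≤-reflexive (∣p++q∣≡∣p∣+∣q∣ S D))

proposition7p4 : (G H : Digraph) (v : Fin (n G)) (γG γH γGH γG' γG'H : ℕ) →
    IsDomNum G γG → IsDomNum H γH → IsDomNum (G □ H) γGH →
    γGH ≡ γG * γH →
    IsDomNum (addPendant G v) γG' → γG' ≡ suc γG →
    SatisfiesVizing (addPendant G v) →
    IsDomNum (addPendant G v □ H) γG'H →
    γG'H ≡ γG' * γH
proposition7p4 G H v γG γH γGH γG' γG'H _ isγH isγGH γGH≡γGγH isγG' refl vizing isγG'H =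
  ≤-antisym upper (vizing H γG' γH γG'H isγG' isγH isγG'H)
  where
  upper : γG'H ≤ γH + γG * γH   -- definitionally suc γG * γH
  upper = subst (λ b → γG'H ≤ γH + b) γGH≡γGγH (domNum-addPendant-□-≤ G H v isγH isγGH isγG'H)
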